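{- In integral hackenbush, for any position and either player to move, the result under optimal play equals the value of the position rounded to the nearest integer, where, if the value is half an odd integer, it is rounded in favor of the player who is not to move (i.e. rounded down if Blue is to move and rounded up if Red is to move).
   Context: A hackenbush pile is a finite stack of counters, listed from bottom to top, each colored blue or red. The weight of a counter is $1$ if no counter of the opposite color lies anywhere below it in its pile; otherwise it is half the weight of the counter immediately below it. A position is a finite collection (formal sum) of piles, and its value is the sum over all counters of their weights, counted positively for blue counters and negatively for red counters. Two players, Blue and Red, move alternately; a move by Blue consists in choosing a pile and a blue counter in it and removing that counter together with all counters stacked above it in that pile; a move by Red is the same with a red counter. In integral hackenbush, the game stops as soon as a position is reached in which every pile is monochromatic (all counters of each pile have the same color; this includes the empty position, and the game stops immediately if the starting position has this property). At that point each player receives one dollar from the other for each of their own remaining counters; the result is the net payment to Blue, namely (number of remaining blue counters) $-$ (number of remaining red counters). Blue tries to maximize and Red to minimize the result; the result under optimal play is the minimax value of this finite game for the given player to move. -}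

module Defs where

open import Data.Bool using (Bool; true; false; if_then_else_)
open import Data.Nat using (ℕ; zero; suc)
import Data.Nat as ℕ
open import Data.Integer using (ℤ; +_; -_)
import Data.Integer as ℤ
open import Data.Rational using (ℚ; 0ℚ; 1ℚ; ½; floor; ceiling)
import Data.Rational as ℚ
open import Data.List using (List; []; _∷_; length; take; map; concatMap; lookup; updateAt; allFin; filter)
open import Data.Fin using (Fin)
open import Data.Nat.ListAction using (sum)
open import Relation.Binary.PropositionalEquality using (_≡_; refl)

allB : {A : Set} → (A → Bool) → List A → Bool
allB p []       = true
allB p (x ∷ xs) = if p x then allB p xs else false

data Colour : Set where
  blue red : Colour

_≡ᶜ_ : Colour → Colour → Bool
blue ≡ᶜ blue = true
red  ≡ᶜ red  = true
_    ≡ᶜ _    = false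

-- A pile is listed from bottom to top.
Pile : Set
Pile = List Colour

Position : Set
Position = List Pile

sign : Colour → ℚ
sign blue = 1ℚ
sign red  = ℚ.- 1ℚ

-- weights-go below w xs : list of weights of the counters xs, where
-- 'below' is the list of counters below (head = counter immediately below)
-- and w is the weight of the counter immediately below.
weightsFrom : List Colour → ℚ → List Colour → List ℚ
weightsFrom below w []       = []
weightsFrom below w (c ∷ cs) =
  let w′ = if allB (_≡ᶜ c) below then 1ℚ else ½ ℚ.* w
  in  w′ ∷ weightsFrom (c ∷ below) w′ cs

weights : Pile → List ℚ
weights p = weightsFrom [] 1ℚ p

sumℚ : List ℚ → ℚ
sumℚ []       = 0ℚ
sumℚ (x ∷ xs) = x ℚ.+ sumℚ xs

signedWeights : List Colour → List ℚ → List ℚ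
signedWeights (c ∷ cs) (w ∷ ws) = sign c ℚ.* w ∷ signedWeights cs ws
signedWeights _        _        = []

pileValue : Pile → ℚ
pileValue p = sumℚ (signedWeights p (weights p))

value : Position → ℚ
value ps = sumℚ (map pileValue ps)

monochromatic : Pile → Bool
monochromatic []       = true
monochromatic (c ∷ cs) = allB (_≡ᶜ c) cs

allMonochromatic : Position → Bool
allMonochromatic ps = allB monochromatic ps

count : Colour → Pile → ℕ
count c p = countGo p
  where
  countGo : Pile → ℕ
  countGo []       = 0
  countGo (d ∷ ds) = (if d ≡ᶜ c then 1 else 0) ℕ.+ countGo ds

-- payment to Blue when the game stops
payoff : Position → ℤ
payoff ps = sumℤ (map (λ p → + count blue p ℤ.- + count red p) ps)
  where
  sumℤ : List ℤ → ℤ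
  sumℤ []       = + 0
  sumℤ (x ∷ xs) = x ℤ.+ sumℤ xs

-- Options of a player: choose pile i and a counter at height j of the
-- player's colour; remove it and everything above it (keep 'take j').
options : Colour → Position → List Position
options c ps =
  concatMap
    (λ i → concatMap
      (λ j → if lookup (lookup ps i) j ≡ᶜ c
               then updateAt ps i (take (Data.Fin.toℕ j)) ∷ []
               else [])
      (allFin (length (lookup ps i))))
    (allFin (length ps))

size : Position → ℕ
size ps = sum (map length ps)

other : Colour → Colour
other blue = red
other red  = blue

maxList : ℤ → List ℤ → ℤ
maxList d []       = d
maxList d (x ∷ []) = x
maxList d (x ∷ xs) = x ℤ.⊔ maxList d xs

minList : ℤ → List ℤ → ℤ
minList d []       = d
minList d (x ∷ []) = x
minList d (x ∷ xs) = x ℤ.⊓ minList d xs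

-- Minimax with fuel; every move removes at least one counter, so fuel
-- size ps + 1 is always enough (the fuel-exhausted and no-option
-- branches are never reached from 'result').
minimax : ℕ → Colour → Position → ℤ
minimax zero     c ps = payoff ps
minimax (suc n) c ps with allMonochromatic ps
... | true  = payoff ps
... | false with c
...   | blue = maxList (payoff ps) (map (minimax n red)  (options blue ps))
...   | red  = minList (payoff ps) (map (minimax n blue) (options red ps))

result : Colour → Position → ℤ
result c ps = minimax (suc (size ps)) c ps

roundFor : Colour → ℚ → ℤ
roundFor blue v = ceiling (v ℚ.- ½)
roundFor red  v = floor (v ℚ.+ ½)

-- A counter of depth e weighs 2⁻ᵉ; reading a pile upwards, depths never
-- decrease, so the value of a position lies on the grid 2⁻ᴰℤ, where D is
-- the largest depth of a top counter (Dyadic-value).  Two facts about a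
-- single pile drive the game:
--   * the counters from one of colour c upwards are worth a positive
--     amount to player c (segment-sign), because everything stacked on a
--     mixed base is worth less than the weight of its top counter
--     (mixed-bound); so every move strictly worsens the value for the
--     mover (moveValue-sign);
--   * if the top counter has depth D ≥ 1, removing the last counter of
--     colour c costs player c exactly 2⁻ᴰ, the run of the other colour
--     above it being a geometric sum (top-counter, smallest-move).
-- By the rounding lemmas round-mono and round-exact, no move changes the
-- rounded value in the mover's favour and the smallest move keeps it, so
-- each turn of minimax returns the rounded value (blue-turn, red-turn).
-- Terminal positions are worth their payoff (value-terminal), and the
-- theorem follows by induction on the fuel of minimax.
module Submission where

open import Data.Bool using (true; false; if_then_else_)
open import Data.Nat as ℕ using (ℕ; zero; suc; _⊔_; z≤n; s≤s)
import Data.Nat.Properties as ℕP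
import Data.Nat.Tactic.RingSolver as ℕSolver
open import Data.Integer as ℤ using (ℤ; +_; -[1+_])
import Data.Integer.Properties as ℤP
import Data.Integer.DivMod as ℤDivMod
import Data.Integer.Tactic.RingSolver as ℤSolver
open import Data.Rational as ℚ using (ℚ; mkℚ; 0ℚ; 1ℚ; ½; floor; ceiling; ∣_∣)
import Data.Rational.Properties as ℚP
import Data.Rational.Unnormalised as ℚᵘ
import Data.Rational.Unnormalised.Properties as ℚᵘP
open import Data.Nat.Coprimality using (1-coprimeTo) renaming (sym to coprime-sym)
open import Data.Maybe using (just; nothing)
open import Data.Product using (Σ; _×_; _,_)
open import Data.Sum using (_⊎_; inj₁; inj₂)
open import Data.Fin using (Fin; zero; suc; toℕ)
open import Data.List using (List; []; _∷_; _++_; map; replicate; length; lookup; take; drop; updateAt; _[_]∷=_)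
open import Data.List.Properties using (length-++)
open import Data.List.Relation.Unary.All as All using (All; []; _∷_)
import Data.List.Relation.Unary.All.Properties as AllP
open import Data.List.Relation.Unary.Any using (Any; here; there)
import Data.List.Relation.Unary.Any.Properties as AnyP
open import Data.List.Membership.Propositional using (_∈_; lose)
open import Relation.Nullary using (yes; no)
open import Relation.Binary.PropositionalEquality
open import Tactic.RingSolver using (solve-∀)
open import Tactic.RingSolver.Core.AlmostCommutativeRing using (AlmostCommutativeRing; fromCommutativeRing)

open import Defs

ℚ-ring : AlmostCommutativeRing _ _
ℚ-ring = fromCommutativeRing ℚP.+-*-commutativeRing isZero
  where
  isZero : (x : ℚ) → _
  isZero x with 0ℚ ℚP.≟ x
  ... | yes p = just p
  ... | no _  = nothing

neg-involutive : ∀ q → ℚ.- (ℚ.- q) ≡ q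
neg-involutive = solve-∀ ℚ-ring

neg-one-* : ∀ x → ℚ.- 1ℚ ℚ.* x ≡ ℚ.- x
neg-one-* x = trans (sym (ℚP.neg-distribˡ-* 1ℚ x)) (cong ℚ.-_ (ℚP.*-identityˡ x))

0<½ : 0ℚ ℚ.< ½
0<½ = ℚ.*<* (ℤ.+<+ (s≤s z≤n))

½<1 : ½ ℚ.< 1ℚ
½<1 = ℚ.*<* (ℤ.+<+ (s≤s (s≤s z≤n)))

-½+1 : ∀ x → x ℚ.- ½ ℚ.+ 1ℚ ≡ x ℚ.+ ½
-½+1 x = regroup x ½
  where
  regroup : ∀ x h → x ℚ.- h ℚ.+ (h ℚ.+ h) ≡ x ℚ.+ h
  regroup = solve-∀ ℚ-ring

<+pos : ∀ x {h} → 0ℚ ℚ.< h → x ℚ.< x ℚ.+ h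
<+pos x 0<h = subst (ℚ._< x ℚ.+ _) (ℚP.+-identityʳ x) (ℚP.+-monoʳ-< x 0<h)

-pos< : ∀ x {h} → 0ℚ ℚ.< h → x ℚ.- h ℚ.< x
-pos< x 0<h = subst (x ℚ.- _ ℚ.<_) (ℚP.+-identityʳ x) (ℚP.+-monoʳ-< x (ℚP.neg-antimono-< 0<h))

0<+ : ∀ {x y} → ℚ.- x ℚ.< y → 0ℚ ℚ.< x ℚ.+ y
0<+ {x} -x<y = subst (ℚ._< x ℚ.+ _) (ℚP.+-inverseʳ x) (ℚP.+-monoʳ-< x -x<y)

p≤∣p∣ : ∀ p → p ℚ.≤ ∣ p ∣
p≤∣p∣ (mkℚ (+ n)    _ _) = ℚP.≤-refl
p≤∣p∣ (mkℚ -[1+ n ] _ _) = ℚ.*≤* ℤ.-≤+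

∣p∣<q⇒-q<p : ∀ {p q} → ∣ p ∣ ℚ.< q → ℚ.- q ℚ.< p
∣p∣<q⇒-q<p {p} {q} ∣p∣<q = subst (ℚ.- q ℚ.<_) (neg-involutive p) (ℚP.neg-antimono-<
  (ℚP.≤-<-trans (p≤∣p∣ (ℚ.- p)) (subst (ℚ._< q) (sym (ℚP.∣-p∣≡∣p∣ p)) ∣p∣<q)))

ι : ℤ → ℚ
ι n = mkℚ n 0 (coprime-sym (1-coprimeTo ℤ.∣ n ∣))

ι-+ : ∀ m n → ι (m ℤ.+ n) ≡ ι m ℚ.+ ι n
ι-+ m n = ℚP.toℚᵘ-injective
  (ℚᵘP.≃-trans (ℚᵘ.*≡* (numerators m n)) (ℚᵘP.≃-sym (ℚP.toℚᵘ-homo-+ (ι m) (ι n))))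
  where
  numerators : ∀ m n → (m ℤ.+ n) ℤ.* + 1 ≡ (m ℤ.* + 1 ℤ.+ n ℤ.* + 1) ℤ.* + 1
  numerators = ℤSolver.solve-∀

ι-neg : ∀ n → ι (ℤ.- n) ≡ ℚ.- ι n
ι-neg (+ zero)  = refl
ι-neg (+ suc n) = refl
ι-neg -[1+ n ]  = refl

ι-mono-≤ : ∀ {m n} → m ℤ.≤ n → ι m ℚ.≤ ι n
ι-mono-≤ {m} {n} m≤n =
  ℚ.*≤* (subst₂ ℤ._≤_ (sym (ℤP.*-identityʳ m)) (sym (ℤP.*-identityʳ n)) m≤n)

ι-cancel-< : ∀ {m n} → ι m ℚ.< ι n → m ℤ.< n
ι-cancel-< {m} {n} (ℚ.*<* m<n) = subst₂ ℤ._<_ (ℤP.*-identityʳ m) (ℤP.*-identityʳ n) m<n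

<+1⇒≤ : ∀ {m n} → ι m ℚ.< ι n ℚ.+ 1ℚ → m ℤ.≤ n
<+1⇒≤ {m} {n} m<n+1 = subst (m ℤ.≤_) (ℤP.pred-suc n) (ℤP.i<j⇒i≤pred[j] m<1+n)
  where
  m<1+n : m ℤ.< ℤ.suc n
  m<1+n = ι-cancel-< (subst (ι m ℚ.<_) (trans (ℚP.+-comm (ι n) 1ℚ) (sym (ι-+ ℤ.1ℤ n))) m<n+1)

floor-≤ : ∀ q → ι (floor q) ℚ.≤ q
floor-≤ (mkℚ n d _) =
  ℚ.*≤* (subst₂ ℤ._≤_ refl (sym (ℤP.*-identityʳ n)) (ℤDivMod.[n/d]*d≤n n (+ suc d)))

<-floor+1 : ∀ q → q ℚ.< ι (floor q) ℚ.+ 1ℚ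
<-floor+1 q@(mkℚ n d _) = subst (q ℚ.<_) (trans (ι-+ ℤ.1ℤ (floor q)) (ℚP.+-comm 1ℚ (ι (floor q))))
  (ℚ.*<* (subst₂ ℤ._<_ (sym (ℤP.*-identityʳ n))
    (cong (λ k → ℤ.suc k ℤ.* + suc d) (sym (ℤDivMod.div-pos-is-/ℕ n (suc d))))
    (ℤDivMod.n<s[n/ℕd]*d n (suc d))))

≤-ceiling : ∀ q → q ℚ.≤ ι (ceiling q)
≤-ceiling q@record{} = subst₂ ℚ._≤_ (neg-involutive q) (sym (ι-neg (floor (ℚ.- q))))
  (ℚP.neg-antimono-≤ (floor-≤ (ℚ.- q)))

ceiling-<+1 : ∀ q → ι (ceiling q) ℚ.< q ℚ.+ 1ℚ
ceiling-<+1 q@record{} = begin-strict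
  ι (ceiling q)              ≡⟨ ι-neg f ⟩
  ℚ.- ι f                    ≡⟨ regroup (ι f) ⟩
  ℚ.- (ι f ℚ.+ 1ℚ) ℚ.+ 1ℚ    <⟨ ℚP.+-monoˡ-< 1ℚ (ℚP.neg-antimono-< (<-floor+1 (ℚ.- q))) ⟩
  ℚ.- (ℚ.- q) ℚ.+ 1ℚ         ≡⟨ cong (ℚ._+ 1ℚ) (neg-involutive q) ⟩
  q ℚ.+ 1ℚ                   ∎
  where
  open ℚP.≤-Reasoning
  f = floor (ℚ.- q)
  regroup : ∀ x → ℚ.- x ≡ ℚ.- (x ℚ.+ 1ℚ) ℚ.+ 1ℚ
  regroup = solve-∀ ℚ-ring

floor-greatest : ∀ {n q} → ι n ℚ.≤ q → n ℤ.≤ floor q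
floor-greatest {q = q} n≤q = <+1⇒≤ (ℚP.≤-<-trans n≤q (<-floor+1 q))

floor-least : ∀ {n q} → q ℚ.< ι n ℚ.+ 1ℚ → floor q ℤ.≤ n
floor-least {q = q} q<n+1 = <+1⇒≤ (ℚP.≤-<-trans (floor-≤ q) q<n+1)

ceiling-least : ∀ {n q} → q ℚ.≤ ι n → ceiling q ℤ.≤ n
ceiling-least {q = q} q≤n = <+1⇒≤ (ℚP.<-≤-trans (ceiling-<+1 q) (ℚP.+-monoˡ-≤ 1ℚ q≤n))

ceiling-greatest : ∀ {n q} → ι n ℚ.< q ℚ.+ 1ℚ → n ℤ.≤ ceiling q
ceiling-greatest {q = q} n<q+1 = <+1⇒≤ (ℚP.<-≤-trans n<q+1 (ℚP.+-monoˡ-≤ 1ℚ (≤-ceiling q)))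

-- ½^ e = 2⁻ᵉ is the weight of a counter of depth e.
½^ : ℕ → ℚ
½^ zero    = 1ℚ
½^ (suc e) = ½ ℚ.* ½^ e

½^-pos : ∀ e → 0ℚ ℚ.< ½^ e
½^-pos zero    = ℚ.*<* (ℤ.+<+ (s≤s z≤n))
½^-pos (suc e) = ℚP.*-monoʳ-<-pos ½ (½^-pos e)

½^-≤1 : ∀ e → ½^ e ℚ.≤ 1ℚ
½^-≤1 zero    = ℚP.≤-refl
½^-≤1 (suc e) = ℚP.≤-trans (ℚP.*-monoˡ-≤-nonNeg ½ (½^-≤1 e)) (ℚP.<⇒≤ ½<1)

½^-halves : ∀ e → ½^ (suc e) ℚ.+ ½^ (suc e) ≡ ½^ e
½^-halves e = trans (distrib ½ (½^ e)) (ℚP.*-identityˡ (½^ e))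
  where
  distrib : ∀ h x → h ℚ.* x ℚ.+ h ℚ.* x ≡ (h ℚ.+ h) ℚ.* x
  distrib = solve-∀ ℚ-ring

record Dyadic (E : ℕ) (x : ℚ) : Set where
  constructor dyadic
  field
    numerator : ℤ
    exact     : x ≡ ι numerator ℚ.* ½^ E

Dyadic-+ : ∀ {E x y} → Dyadic E x → Dyadic E y → Dyadic E (x ℚ.+ y)
Dyadic-+ {E} (dyadic k refl) (dyadic l refl) = dyadic (k ℤ.+ l)
  (trans (sym (ℚP.*-distribʳ-+ (½^ E) (ι k) (ι l))) (cong (ℚ._* ½^ E) (sym (ι-+ k l))))

Dyadic-neg : ∀ {E x} → Dyadic E x → Dyadic E (ℚ.- x)
Dyadic-neg {E} (dyadic k refl) = dyadic (ℤ.- k)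
  (trans (ℚP.neg-distribˡ-* (ι k) (½^ E)) (cong (ℚ._* ½^ E) (sym (ι-neg k))))

Dyadic-refine : ∀ {E x} → Dyadic E x → Dyadic (suc E) x
Dyadic-refine {E} (dyadic k refl) = dyadic (k ℤ.+ k) (begin
  ι k ℚ.* ½^ E                                 ≡⟨ cong (ι k ℚ.*_) (sym (½^-halves E)) ⟩
  ι k ℚ.* (½^ (suc E) ℚ.+ ½^ (suc E))          ≡⟨ ℚP.*-distribˡ-+ (ι k) (½^ (suc E)) (½^ (suc E)) ⟩
  ι k ℚ.* ½^ (suc E) ℚ.+ ι k ℚ.* ½^ (suc E)    ≡⟨ ℚP.*-distribʳ-+ (½^ (suc E)) (ι k) (ι k) ⟨
  (ι k ℚ.+ ι k) ℚ.* ½^ (suc E)                 ≡⟨ cong (ℚ._* ½^ (suc E)) (sym (ι-+ k k)) ⟩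
  ι (k ℤ.+ k) ℚ.* ½^ (suc E)                   ∎)
  where open ≡-Reasoning

Dyadic-weaken : ∀ {E F x} → E ℕ.≤ F → Dyadic E x → Dyadic F x
Dyadic-weaken E≤F = go (ℕP.≤⇒≤′ E≤F)
  where
  go : ∀ {E F x} → E ℕ.≤′ F → Dyadic E x → Dyadic F x
  go ℕ.≤′-refl       d = d
  go (ℕ.≤′-step E≤F) d = Dyadic-refine (go E≤F d)

Dyadic-½^ : ∀ {e E} → e ℕ.≤ E → Dyadic E (½^ e)
Dyadic-½^ {e} e≤E = Dyadic-weaken e≤E (dyadic ℤ.1ℤ (sym (ℚP.*-identityˡ (½^ e))))

Dyadic-ι : ∀ {E} n → Dyadic E (ι n)
Dyadic-ι n = Dyadic-weaken z≤n (dyadic n (sym (ℚP.*-identityʳ (ι n))))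

Dyadic-gap : ∀ {E x y} → Dyadic E x → Dyadic E y → x ℚ.< y → x ℚ.+ ½^ E ℚ.≤ y
Dyadic-gap {E} (dyadic k refl) (dyadic l refl) x<y = begin
  ι k ℚ.* ½^ E ℚ.+ ½^ E           ≡⟨ cong (ι k ℚ.* ½^ E ℚ.+_) (sym (ℚP.*-identityˡ (½^ E))) ⟩
  ι k ℚ.* ½^ E ℚ.+ 1ℚ ℚ.* ½^ E    ≡⟨ ℚP.*-distribʳ-+ (½^ E) (ι k) 1ℚ ⟨
  (ι k ℚ.+ 1ℚ) ℚ.* ½^ E           ≡⟨ cong (ℚ._* ½^ E) (sym (ι-+ k ℤ.1ℤ)) ⟩
  ι (k ℤ.+ ℤ.1ℤ) ℚ.* ½^ E         ≤⟨ ℚP.*-monoʳ-≤-nonNeg (½^ E) (ι-mono-≤ k+1≤l) ⟩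
  ι l ℚ.* ½^ E                    ∎
  where
  open ℚP.≤-Reasoning
  instance
    nonNeg : ℚ.NonNegative (½^ E)
    nonNeg = ℚP.pos⇒nonNeg (½^ E) {{ℚ.positive (½^-pos E)}}
  k+1≤l : k ℤ.+ ℤ.1ℤ ℤ.≤ l
  k+1≤l = subst (ℤ._≤ l) (ℤP.+-comm ℤ.1ℤ k)
    (ℤP.i<j⇒suc[i]≤j (ι-cancel-< (ℚP.*-cancelʳ-<-nonNeg (½^ E) x<y)))

roundFor-ι : ∀ c n → roundFor c (ι n) ≡ n
roundFor-ι blue n = ℤP.≤-antisym
  (ceiling-least {q = ι n ℚ.- ½} (ℚP.<⇒≤ (-pos< (ι n) 0<½)))
  (ceiling-greatest {q = ι n ℚ.- ½} (subst (ι n ℚ.<_) (sym (-½+1 (ι n))) (<+pos (ι n) 0<½)))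
roundFor-ι red n = ℤP.≤-antisym
  (floor-least {q = ι n ℚ.+ ½} (ℚP.+-monoʳ-< (ι n) ½<1))
  (floor-greatest {q = ι n ℚ.+ ½} (ℚP.<⇒≤ (<+pos (ι n) 0<½)))

-- If x < y, then x rounded for Blue to move cannot exceed y rounded for
-- Red to move: a move lowering the value never helps Blue, and a move
-- raising it never helps Red.
round-mono : ∀ {x y} → x ℚ.< y → floor (x ℚ.+ ½) ℤ.≤ ceiling (y ℚ.- ½)
round-mono {x} {y} x<y = floor-least (begin-strict
  x ℚ.+ ½                         <⟨ ℚP.+-monoˡ-< ½ x<y ⟩
  y ℚ.+ ½                         ≡⟨ -½+1 y ⟨
  y ℚ.- ½ ℚ.+ 1ℚ                  ≤⟨ ℚP.+-monoˡ-≤ 1ℚ (≤-ceiling (y ℚ.- ½)) ⟩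
  ι (ceiling (y ℚ.- ½)) ℚ.+ 1ℚ    ∎)
  where open ℚP.≤-Reasoning

-- On a grid 2⁻ᴱℤ with E ≥ 1, so that ½ is a grid point, a single grid
-- step from x up to y preserves the rounding of round-mono.
round-exact : ∀ {E} x {y} → Dyadic E y → 1 ℕ.≤ E → x ℚ.+ ½^ E ≡ y →
              floor (x ℚ.+ ½) ≡ ceiling (y ℚ.- ½)
round-exact {E} x {y} y-dyadic 1≤E x+u≡y =
  ℤP.≤-antisym (round-mono x<y) (floor-greatest (begin
    ι n                          ≡⟨ add-sub (ι n) (½^ E) ⟨
    ι n ℚ.+ ½^ E ℚ.- ½^ E        ≤⟨ ℚP.+-monoˡ-≤ (ℚ.- ½^ E) n+u≤y+½ ⟩
    y ℚ.+ ½ ℚ.- ½^ E             ≡⟨ cong (λ z → z ℚ.+ ½ ℚ.- ½^ E) x+u≡y ⟨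
    x ℚ.+ ½^ E ℚ.+ ½ ℚ.- ½^ E    ≡⟨ shift x (½^ E) ½ ⟩
    x ℚ.+ ½                      ∎))
  where
  open ℚP.≤-Reasoning
  n = ceiling (y ℚ.- ½)
  x<y : x ℚ.< y
  x<y = subst (x ℚ.<_) x+u≡y (<+pos x (½^-pos E))
  n<y+½ : ι n ℚ.< y ℚ.+ ½
  n<y+½ = subst (ι n ℚ.<_) (-½+1 y) (ceiling-<+1 (y ℚ.- ½))
  n+u≤y+½ : ι n ℚ.+ ½^ E ℚ.≤ y ℚ.+ ½
  n+u≤y+½ = Dyadic-gap (Dyadic-ι n) (Dyadic-+ y-dyadic (Dyadic-½^ 1≤E)) n<y+½
  add-sub : ∀ a u → a ℚ.+ u ℚ.- u ≡ a
  add-sub = solve-∀ ℚ-ring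
  shift : ∀ a u h → a ℚ.+ u ℚ.+ h ℚ.- u ≡ a ℚ.+ h
  shift = solve-∀ ℚ-ring

≡ᶜ-refl : ∀ c → (c ≡ᶜ c) ≡ true
≡ᶜ-refl blue = refl
≡ᶜ-refl red  = refl

≡ᶜ-sound : ∀ {c d} → (c ≡ᶜ d) ≡ true → c ≡ d
≡ᶜ-sound {blue} {blue} _ = refl
≡ᶜ-sound {red}  {red}  _ = refl

≡ᶜ-other : ∀ c → (c ≡ᶜ other c) ≡ false
≡ᶜ-other blue = refl
≡ᶜ-other red  = refl

allB-same : ∀ c cs → allB (_≡ᶜ c) (c ∷ cs) ≡ allB (_≡ᶜ c) cs
allB-same c cs rewrite ≡ᶜ-refl c = refl

allB-other : ∀ c cs → allB (_≡ᶜ other c) (c ∷ cs) ≡ false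
allB-other c cs rewrite ≡ᶜ-other c = refl

same-or-other : ∀ c d → d ≡ c ⊎ d ≡ other c
same-or-other blue blue = inj₁ refl
same-or-other blue red  = inj₂ refl
same-or-other red  red  = inj₁ refl
same-or-other red  blue = inj₂ refl

sign-other : ∀ c → sign (other c) ≡ ℚ.- sign c
sign-other blue = refl
sign-other red  = refl

sign-* : ∀ c d w v → sign c ℚ.* (sign d ℚ.* w ℚ.+ v) ≡ (sign c ℚ.* sign d) ℚ.* w ℚ.+ sign c ℚ.* v
sign-* c d = distrib (sign c) (sign d)
  where
  distrib : ∀ s t w v → s ℚ.* (t ℚ.* w ℚ.+ v) ≡ (s ℚ.* t) ℚ.* w ℚ.+ s ℚ.* v
  distrib = solve-∀ ℚ-ring

sign-same : ∀ c w v → sign c ℚ.* (sign c ℚ.* w ℚ.+ v) ≡ w ℚ.+ sign c ℚ.* v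
sign-same c w v = trans (sign-* c c w v)
  (cong (ℚ._+ sign c ℚ.* v) (trans (cong (ℚ._* w) (sign² c)) (ℚP.*-identityˡ w)))
  where
  sign² : ∀ c → sign c ℚ.* sign c ≡ 1ℚ
  sign² blue = refl
  sign² red  = refl

sign-opposite : ∀ c w v → sign c ℚ.* (sign (other c) ℚ.* w ℚ.+ v) ≡ ℚ.- w ℚ.+ sign c ℚ.* v
sign-opposite c w v = trans (sign-* c (other c) w v)
  (cong (ℚ._+ sign c ℚ.* v) (trans (cong (ℚ._* w) (sign-product c)) (neg-one-* w)))
  where
  sign-product : ∀ c → sign c ℚ.* sign (other c) ≡ ℚ.- 1ℚ
  sign-product blue = refl
  sign-product red  = refl

∣sign-*∣ : ∀ c x → ∣ sign c ℚ.* x ∣ ≡ ∣ x ∣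
∣sign-*∣ c x = trans (ℚP.∣p*q∣≡∣p∣*∣q∣ (sign c) x)
  (trans (cong (ℚ._* ∣ x ∣) (∣sign∣ c)) (ℚP.*-identityˡ ∣ x ∣))
  where
  ∣sign∣ : ∀ c → ∣ sign c ∣ ≡ 1ℚ
  ∣sign∣ blue = refl
  ∣sign∣ red  = refl

sign-bound : ∀ c {v w} → ∣ v ∣ ℚ.< w → ℚ.- w ℚ.< sign c ℚ.* v
sign-bound c {v} ∣v∣<w = ∣p∣<q⇒-q<p (subst (ℚ._< _) (sym (∣sign-*∣ c v)) ∣v∣<w)

Dyadic-sign : ∀ {E x} c → Dyadic E x → Dyadic E (sign c ℚ.* x)
Dyadic-sign {x = x} blue d = subst (Dyadic _) (sym (ℚP.*-identityˡ x)) d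
Dyadic-sign {x = x} red  d = subst (Dyadic _) (sym (neg-one-* x)) (Dyadic-neg d)

-- The base of the next counter consists
-- of the counters read so far (topmost first) and the depth e of the
-- topmost one, whose weight is 2⁻ᵉ; the empty pile is the ground.
record Base : Set where
  constructor base
  field
    below : List Colour
    depth : ℕ

open Base

ground : Base
ground = base [] 0

push : Base → Colour → Base
push (base cs e) c = base (c ∷ cs) (if allB (_≡ᶜ c) cs then 0 else suc e)

pushAll : Base → Pile → Base
pushAll κ []       = κ
pushAll κ (c ∷ cs) = pushAll (push κ c) cs

stackValue : Base → Pile → ℚ
stackValue κ []       = 0ℚ
stackValue κ (c ∷ cs) = sign c ℚ.* ½^ (depth (push κ c)) ℚ.+ stackValue (push κ c) cs

topDepth : Pile → ℕ
topDepth p = depth (pushAll ground p)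

stackValue-weights : ∀ cs e cs′ →
  sumℚ (signedWeights cs′ (weightsFrom cs (½^ e) cs′)) ≡ stackValue (base cs e) cs′
stackValue-weights cs e []        = refl
stackValue-weights cs e (c ∷ cs′) with allB (_≡ᶜ c) cs
... | true  = cong (sign c ℚ.* 1ℚ ℚ.+_) (stackValue-weights (c ∷ cs) 0 cs′)
... | false = cong (sign c ℚ.* ½^ (suc e) ℚ.+_) (stackValue-weights (c ∷ cs) (suc e) cs′)

pileValue≡stackValue : ∀ p → pileValue p ≡ stackValue ground p
pileValue≡stackValue = stackValue-weights [] 0

pushAll-++ : ∀ κ xs ys → pushAll κ (xs ++ ys) ≡ pushAll (pushAll κ xs) ys
pushAll-++ κ []       ys = refl
pushAll-++ κ (c ∷ xs) ys = pushAll-++ (push κ c) xs ys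

stackValue-++ : ∀ κ xs ys →
  stackValue κ (xs ++ ys) ≡ stackValue κ xs ℚ.+ stackValue (pushAll κ xs) ys
stackValue-++ κ []       ys = sym (ℚP.+-identityˡ _)
stackValue-++ κ (c ∷ xs) ys = trans
  (cong (w ℚ.+_) (stackValue-++ (push κ c) xs ys))
  (sym (ℚP.+-assoc w (stackValue (push κ c) xs) _))
  where w = sign c ℚ.* ½^ (depth (push κ c))

pileValue-++ : ∀ xs ys →
  pileValue (xs ++ ys) ≡ pileValue xs ℚ.+ stackValue (pushAll ground xs) ys
pileValue-++ xs ys = begin
  pileValue (xs ++ ys)                                     ≡⟨ pileValue≡stackValue (xs ++ ys) ⟩
  stackValue ground (xs ++ ys)                             ≡⟨ stackValue-++ ground xs ys ⟩
  stackValue ground xs ℚ.+ stackValue (pushAll ground xs) ys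
    ≡⟨ cong (ℚ._+ stackValue (pushAll ground xs) ys) (pileValue≡stackValue xs) ⟨
  pileValue xs ℚ.+ stackValue (pushAll ground xs) ys       ∎
  where open ≡-Reasoning

Consistent : Base → Set
Consistent κ = ∀ c → allB (_≡ᶜ c) (below κ) ≡ true → depth κ ≡ 0

ground-consistent : Consistent ground
ground-consistent _ _ = refl

push-consistent : ∀ κ d → Consistent (push κ d)
push-consistent (base cs e) d c all-c with d ≡ᶜ c in d≡c
... | true rewrite ≡ᶜ-sound d≡c | all-c = refl

depth-push-mono : ∀ κ c → Consistent κ → depth κ ℕ.≤ depth (push κ c)
depth-push-mono (base cs e) c κ-consistent with allB (_≡ᶜ c) cs in all-c
... | true  = ℕP.≤-reflexive (κ-consistent c all-c)
... | false = ℕP.n≤1+n e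

depth-mono : ∀ κ cs → Consistent κ → depth κ ℕ.≤ depth (pushAll κ cs)
depth-mono κ []       _            = ℕP.≤-refl
depth-mono κ (c ∷ cs) κ-consistent = ℕP.≤-trans (depth-push-mono κ c κ-consistent)
  (depth-mono (push κ c) cs (push-consistent κ c))

-- Hence every counter weight is a multiple of the top weight of its
-- pile, and so is the value of the pile.
Dyadic-stack : ∀ {E} κ cs → Consistent κ → depth (pushAll κ cs) ℕ.≤ E → Dyadic E (stackValue κ cs)
Dyadic-stack κ []       _ _     = Dyadic-ι (+ 0)
Dyadic-stack κ (c ∷ cs) _ top≤E = Dyadic-+
  (Dyadic-sign c (Dyadic-½^ (ℕP.≤-trans (depth-mono (push κ c) cs (push-consistent κ c)) top≤E)))
  (Dyadic-stack (push κ c) cs (push-consistent κ c) top≤E)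

Dyadic-pileValue : ∀ {E} p → topDepth p ℕ.≤ E → Dyadic E (pileValue p)
Dyadic-pileValue p top≤E = subst (Dyadic _) (sym (pileValue≡stackValue p))
  (Dyadic-stack ground p ground-consistent top≤E)

-- A base is mixed if it contains counters of both colours; every counter
-- placed on it has half the weight of the one below.
Mixed : Base → Set
Mixed κ = ∀ d → allB (_≡ᶜ d) (below κ) ≡ false

mixed-after : ∀ c cs e → allB (_≡ᶜ c) cs ≡ false → Mixed (base (c ∷ cs) e)
mixed-after c cs e not-all-c d with same-or-other c d
... | inj₁ refl = trans (allB-same c cs) not-all-c
... | inj₂ refl = allB-other c cs

Pure : Colour → Base → Set
Pure c κ = allB (_≡ᶜ c) (below κ) ≡ true × allB (_≡ᶜ other c) (below κ) ≡ false

-- On a mixed base of depth e, the counters above are worth less than 2⁻ᵉ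
-- in absolute value: their weights are 2⁻⁽ᵉ⁺¹⁾, 2⁻⁽ᵉ⁺²⁾, ...
mixed-bound : ∀ κ cs → Mixed κ → ∣ stackValue κ cs ∣ ℚ.< ½^ (depth κ)
mixed-bound (base _  e) []       _     = ½^-pos e
mixed-bound (base bs e) (c ∷ cs) mixed rewrite mixed c = begin-strict
  ∣ sign c ℚ.* w ℚ.+ v ∣        ≤⟨ ℚP.∣p+q∣≤∣p∣+∣q∣ (sign c ℚ.* w) v ⟩
  ∣ sign c ℚ.* w ∣ ℚ.+ ∣ v ∣    ≡⟨ cong (ℚ._+ ∣ v ∣) (trans (∣sign-*∣ c w) ∣w∣≡w) ⟩
  w ℚ.+ ∣ v ∣                   <⟨ ℚP.+-monoʳ-< w ∣v∣<w ⟩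
  w ℚ.+ w                       ≡⟨ ½^-halves e ⟩
  ½^ e                          ∎
  where
  open ℚP.≤-Reasoning
  w = ½^ (suc e)
  κ′ = base (c ∷ bs) (suc e)
  v = stackValue κ′ cs
  ∣w∣≡w : ∣ w ∣ ≡ w
  ∣w∣≡w = ℚP.0≤p⇒∣p∣≡p (ℚP.<⇒≤ (½^-pos (suc e)))
  ∣v∣<w : ∣ v ∣ ℚ.< w
  ∣v∣<w = mixed-bound κ′ cs (mixed-after c bs (suc e) (mixed c))

pure-bound : ∀ c κ cs → Pure c κ → ℚ.- 1ℚ ℚ.< sign c ℚ.* stackValue κ cs

segment-sign : ∀ κ c cs → 0ℚ ℚ.< sign c ℚ.* stackValue κ (c ∷ cs)

pure-bound c κ []       _    = subst (ℚ.- 1ℚ ℚ.<_) (sym (ℚP.*-zeroʳ (sign c))) (ℚ.*<* ℤ.-<+)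
pure-bound c κ (d ∷ cs) pure with same-or-other c d
... | inj₁ refl = ℚP.<-trans (ℚ.*<* ℤ.-<+) (segment-sign κ c cs)
pure-bound c (base bs e) (d ∷ cs) (_ , not-all-other) | inj₂ refl rewrite not-all-other =
  begin-strict
    ℚ.- 1ℚ                                     ≤⟨ ℚP.neg-antimono-≤ (½^-≤1 e) ⟩
    ℚ.- ½^ e                                   ≡⟨ cong ℚ.-_ (½^-halves e) ⟨
    ℚ.- (w ℚ.+ w)                              ≡⟨ ℚP.neg-distrib-+ w w ⟩
    ℚ.- w ℚ.+ ℚ.- w                            <⟨ ℚP.+-monoʳ-< (ℚ.- w) (sign-bound c ∣v∣<w) ⟩
    ℚ.- w ℚ.+ sign c ℚ.* v                     ≡⟨ sign-opposite c w v ⟨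
    sign c ℚ.* (sign (other c) ℚ.* w ℚ.+ v)    ∎
  where
  open ℚP.≤-Reasoning
  w = ½^ (suc e)
  κ′ = base (other c ∷ bs) (suc e)
  v = stackValue κ′ cs
  ∣v∣<w : ∣ v ∣ ℚ.< w
  ∣v∣<w = mixed-bound κ′ cs (mixed-after (other c) bs (suc e) not-all-other)

segment-sign (base bs e) c cs with allB (_≡ᶜ c) bs in all-c
... | true  = subst (0ℚ ℚ.<_) (sym (sign-same c 1ℚ v)) (0<+ {1ℚ} (pure-bound c κ′ cs pure))
  where
  κ′ = base (c ∷ bs) 0
  v = stackValue κ′ cs
  pure : Pure c κ′
  pure = trans (allB-same c bs) all-c , allB-other c bs
... | false = subst (0ℚ ℚ.<_) (sym (sign-same c w v)) (0<+ (sign-bound c ∣v∣<w))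
  where
  w = ½^ (suc e)
  κ′ = base (c ∷ bs) (suc e)
  v = stackValue κ′ cs
  ∣v∣<w : ∣ v ∣ ℚ.< w
  ∣v∣<w = mixed-bound κ′ cs (mixed-after c bs (suc e) all-c)

run-depth : ∀ d bs e r → allB (_≡ᶜ d) bs ≡ false →
  depth (pushAll (base bs e) (replicate r d)) ≡ r ℕ.+ e
run-depth d bs e zero    _         = refl
run-depth d bs e (suc r) not-all-d rewrite not-all-d =
  trans (run-depth d (d ∷ bs) (suc e) r (trans (allB-same d bs) not-all-d)) (ℕP.+-suc r e)

-- ... so it is worth the geometric sum 2⁻⁽ᵉ⁺¹⁾ + ... + 2⁻⁽ᵉ⁺ʳ⁾ = 2⁻ᵉ - 2⁻⁽ᵉ⁺ʳ⁾.
run-value : ∀ d bs e r → allB (_≡ᶜ d) bs ≡ false →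
  stackValue (base bs e) (replicate r d) ≡ sign d ℚ.* (½^ e ℚ.- ½^ (r ℕ.+ e))
run-value d bs e zero    _         =
  sym (trans (cong (sign d ℚ.*_) (ℚP.+-inverseʳ (½^ e))) (ℚP.*-zeroʳ (sign d)))
run-value d bs e (suc r) not-all-d rewrite not-all-d = begin
  sign d ℚ.* w ℚ.+ stackValue (base (d ∷ bs) (suc e)) (replicate r d)
    ≡⟨ cong (sign d ℚ.* w ℚ.+_) (run-value d (d ∷ bs) (suc e) r (trans (allB-same d bs) not-all-d)) ⟩
  sign d ℚ.* w ℚ.+ sign d ℚ.* (w ℚ.- ½^ (r ℕ.+ suc e))
    ≡⟨ telescope (sign d) w (½^ (r ℕ.+ suc e)) ⟩
  sign d ℚ.* ((w ℚ.+ w) ℚ.- ½^ (r ℕ.+ suc e))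
    ≡⟨ cong₂ (λ a b → sign d ℚ.* (a ℚ.- ½^ b)) (½^-halves e) (ℕP.+-suc r e) ⟩
  sign d ℚ.* (½^ e ℚ.- ½^ (suc r ℕ.+ e))
    ∎
  where
  open ≡-Reasoning
  w = ½^ (suc e)
  telescope : ∀ s w z → s ℚ.* w ℚ.+ s ℚ.* (w ℚ.- z) ≡ s ℚ.* ((w ℚ.+ w) ℚ.- z)
  telescope = solve-∀ ℚ-ring

last-counter-value : ∀ κ c r → let top = c ∷ replicate r (other c) in
  stackValue κ top ≡ sign c ℚ.* ½^ (depth (pushAll κ top))
last-counter-value (base bs e) c r = begin
  sign c ℚ.* ½^ e′ ℚ.+ stackValue (base (c ∷ bs) e′) (replicate r (other c))
    ≡⟨ cong (sign c ℚ.* ½^ e′ ℚ.+_) (run-value (other c) (c ∷ bs) e′ r (allB-other c bs)) ⟩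
  sign c ℚ.* ½^ e′ ℚ.+ sign (other c) ℚ.* (½^ e′ ℚ.- ½^ (r ℕ.+ e′))
    ≡⟨ cong (λ s → sign c ℚ.* ½^ e′ ℚ.+ s ℚ.* (½^ e′ ℚ.- ½^ (r ℕ.+ e′))) (sign-other c) ⟩
  sign c ℚ.* ½^ e′ ℚ.+ ℚ.- sign c ℚ.* (½^ e′ ℚ.- ½^ (r ℕ.+ e′))
    ≡⟨ cancel (sign c) (½^ e′) (½^ (r ℕ.+ e′)) ⟩
  sign c ℚ.* ½^ (r ℕ.+ e′)
    ≡⟨ cong (λ k → sign c ℚ.* ½^ k) (run-depth (other c) (c ∷ bs) e′ r (allB-other c bs)) ⟨
  sign c ℚ.* ½^ (depth (pushAll (base (c ∷ bs) e′) (replicate r (other c))))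
    ∎
  where
  open ≡-Reasoning
  e′ = depth (push (base bs e) c)
  cancel : ∀ s a b → s ℚ.* a ℚ.+ ℚ.- s ℚ.* (a ℚ.- b) ≡ s ℚ.* b
  cancel = solve-∀ ℚ-ring

split-last : ∀ c p →
  (Σ Pile λ pre → Σ ℕ λ r → p ≡ pre ++ c ∷ replicate r (other c)) ⊎
  (Σ ℕ λ n → p ≡ replicate n (other c))
split-last c []       = inj₂ (0 , refl)
split-last c (d ∷ ds) with split-last c ds
... | inj₁ (pre , r , eq) = inj₁ (d ∷ pre , r , cong (d ∷_) eq)
... | inj₂ (n , eq) with same-or-other c d
...   | inj₁ refl = inj₁ ([] , n , cong (c ∷_) eq)
...   | inj₂ refl = inj₂ (suc n , cong (other c ∷_) eq)

uniform-depth : ∀ d bs n → allB (_≡ᶜ d) bs ≡ true → depth (pushAll (base bs 0) (replicate n d)) ≡ 0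
uniform-depth d bs zero    _     = refl
uniform-depth d bs (suc n) all-d rewrite all-d =
  uniform-depth d (d ∷ bs) n (trans (allB-same d bs) all-d)

top-counter : ∀ c p → 1 ℕ.≤ topDepth p →
  Σ Pile λ pre → Σ ℕ λ r → p ≡ pre ++ c ∷ replicate r (other c) ×
    stackValue (pushAll ground pre) (c ∷ replicate r (other c)) ≡ sign c ℚ.* ½^ (topDepth p)
top-counter c p 1≤top with split-last c p
... | inj₂ (n , refl) rewrite uniform-depth (other c) [] n refl with 1≤top
...   | ()
top-counter c p 1≤top | inj₁ (pre , r , refl) = pre , r , refl ,
  trans (last-counter-value (pushAll ground pre) c r)
        (cong (λ κ → sign c ℚ.* ½^ (depth κ)) (sym (pushAll-++ ground pre (c ∷ replicate r (other c)))))

-- A pile with counters of both colours has a top counter of depth ≥ 1: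
-- the first counter of the other colour on a pure base has depth ≥ 1.
pure-depth : ∀ c bs e cs → Pure c (base bs e) → allB (_≡ᶜ c) cs ≡ false →
  1 ℕ.≤ depth (pushAll (base bs e) cs)
pure-depth c bs e (d ∷ cs) (all-c , not-all-other) not-all-c with same-or-other c d
... | inj₁ refl rewrite all-c = pure-depth c (c ∷ bs) 0 cs
  (trans (allB-same c bs) all-c , allB-other c bs) (trans (sym (allB-same c cs)) not-all-c)
... | inj₂ refl = ℕP.≤-trans 1≤depth (depth-mono κ′ cs (push-consistent (base bs e) (other c)))
  where
  κ′ = push (base bs e) (other c)
  1≤depth : 1 ℕ.≤ depth κ′
  1≤depth rewrite not-all-other = s≤s z≤n

deep-if-mixed : ∀ p → monochromatic p ≡ false → 1 ℕ.≤ topDepth p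
deep-if-mixed (c ∷ cs) not-mono = pure-depth c (c ∷ []) 0 cs (allB-same c [] , allB-other c []) not-mono

record Move (c : Colour) (ps : Position) : Set where
  constructor move
  field
    pile    : Fin (length ps)
    kept    : Pile
    removed : Pile
    split   : lookup ps pile ≡ kept ++ c ∷ removed

open Move

play : ∀ {c ps} → Move c ps → Position
play {ps = ps} m = ps [ pile m ]∷= kept m

moveValue : ∀ {c ps} → Move c ps → ℚ
moveValue {c} m = stackValue (pushAll ground (kept m)) (c ∷ removed m)

moveValue-sign : ∀ {c ps} (m : Move c ps) → 0ℚ ℚ.< sign c ℚ.* moveValue m
moveValue-sign {c} m = segment-sign (pushAll ground (kept m)) c (removed m)

value-∷= : ∀ ps i q → value (ps [ i ]∷= q) ℚ.+ pileValue (lookup ps i) ≡ value ps ℚ.+ pileValue q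
value-∷= (p ∷ ps) zero    q = swap (pileValue q) (value ps) (pileValue p)
  where
  swap : ∀ a v b → a ℚ.+ v ℚ.+ b ≡ b ℚ.+ v ℚ.+ a
  swap = solve-∀ ℚ-ring
value-∷= (p ∷ ps) (suc i) q = begin
  P ℚ.+ value (ps [ i ]∷= q) ℚ.+ pileValue (lookup ps i)    ≡⟨ ℚP.+-assoc P _ _ ⟩
  P ℚ.+ (value (ps [ i ]∷= q) ℚ.+ pileValue (lookup ps i))  ≡⟨ cong (P ℚ.+_) (value-∷= ps i q) ⟩
  P ℚ.+ (value ps ℚ.+ pileValue q)                          ≡⟨ ℚP.+-assoc P _ _ ⟨
  P ℚ.+ value ps ℚ.+ pileValue q                            ∎
  where
  open ≡-Reasoning
  P = pileValue p

value-play : ∀ {c ps} (m : Move c ps) → value ps ≡ value (play m) ℚ.+ moveValue m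
value-play {c} {ps} m = begin
  value ps                                      ≡⟨ add-sub (value ps) K ⟨
  value ps ℚ.+ K ℚ.- K                          ≡⟨ cong (ℚ._- K) (value-∷= ps (pile m) (kept m)) ⟨
  A ℚ.+ pileValue (lookup ps (pile m)) ℚ.- K    ≡⟨ cong (λ p → A ℚ.+ pileValue p ℚ.- K) (split m) ⟩
  A ℚ.+ pileValue (kept m ++ c ∷ removed m) ℚ.- K
    ≡⟨ cong (λ x → A ℚ.+ x ℚ.- K) (pileValue-++ (kept m) (c ∷ removed m)) ⟩
  A ℚ.+ (K ℚ.+ moveValue m) ℚ.- K               ≡⟨ regroup A K (moveValue m) ⟩
  A ℚ.+ moveValue m                             ∎
  where
  open ≡-Reasoning
  A = value (play m)
  K = pileValue (kept m)
  add-sub : ∀ a b → a ℚ.+ b ℚ.- b ≡ a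
  add-sub = solve-∀ ℚ-ring
  regroup : ∀ a k r → a ℚ.+ (k ℚ.+ r) ℚ.- k ≡ a ℚ.+ r
  regroup = solve-∀ ℚ-ring

size-∷= : ∀ ps i q → size (ps [ i ]∷= q) ℕ.+ length (lookup ps i) ≡ size ps ℕ.+ length q
size-∷= (p ∷ ps) zero    q = swap (length q) (size ps) (length p)
  where
  swap : ∀ a v b → a ℕ.+ v ℕ.+ b ≡ b ℕ.+ v ℕ.+ a
  swap = ℕSolver.solve-∀
size-∷= (p ∷ ps) (suc i) q = begin
  L ℕ.+ size (ps [ i ]∷= q) ℕ.+ length (lookup ps i)    ≡⟨ ℕP.+-assoc L _ _ ⟩
  L ℕ.+ (size (ps [ i ]∷= q) ℕ.+ length (lookup ps i))  ≡⟨ cong (L ℕ.+_) (size-∷= ps i q) ⟩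
  L ℕ.+ (size ps ℕ.+ length q)                          ≡⟨ ℕP.+-assoc L _ _ ⟨
  L ℕ.+ size ps ℕ.+ length q                            ∎
  where
  open ≡-Reasoning
  L = length p

-- Every move removes at least one counter, so one unit of fuel less
-- suffices for minimax after it.
size-play : ∀ {c ps} (m : Move c ps) → size (play m) ℕ.< size ps
size-play {c} {ps} m = ℕP.+-cancelʳ-< (length (lookup ps (pile m))) (size (play m)) (size ps)
  (begin-strict
    size (play m) ℕ.+ length (lookup ps (pile m))    ≡⟨ size-∷= ps (pile m) (kept m) ⟩
    size ps ℕ.+ length (kept m)                      <⟨ ℕP.+-monoʳ-< (size ps) kept<pile ⟩
    size ps ℕ.+ length (lookup ps (pile m))          ∎)
  where
  open ℕP.≤-Reasoning
  kept<pile : length (kept m) ℕ.< length (lookup ps (pile m))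
  kept<pile rewrite split m | length-++ (kept m) {c ∷ removed m} =
    ℕP.m<m+n (length (kept m)) (s≤s z≤n)

play-fuel : ∀ {c ps n} → size ps ℕ.< suc n → (m : Move c ps) → size (play m) ℕ.< n
play-fuel size<1+n m = ℕP.<-≤-trans (size-play m) (ℕP.≤-pred size<1+n)

updateAt≡∷= : ∀ (ps : Position) i f → updateAt ps i f ≡ ps [ i ]∷= f (lookup ps i)
updateAt≡∷= (p ∷ ps) zero    f = refl
updateAt≡∷= (p ∷ ps) (suc i) f = cong (p ∷_) (updateAt≡∷= ps i f)

split-at : ∀ (p : Pile) j → p ≡ take (toℕ j) p ++ lookup p j ∷ drop (suc (toℕ j)) p
split-at (c ∷ p) zero    = refl
split-at (c ∷ p) (suc j) = cong (c ∷_) (split-at p j)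

options-sound : ∀ c ps → All (λ o → Σ (Move c ps) λ m → o ≡ play m) (options c ps)
options-sound c ps = AllP.concat⁺ (AllP.map⁺ (AllP.tabulate⁺ λ i →
                       AllP.concat⁺ (AllP.map⁺ (AllP.tabulate⁺ λ j → option i j))))
  where
  option : ∀ i j → All (λ o → Σ (Move c ps) λ m → o ≡ play m)
    (if lookup (lookup ps i) j ≡ᶜ c then updateAt ps i (take (toℕ j)) ∷ [] else [])
  option i j with lookup (lookup ps i) j ≡ᶜ c in is-c
  ... | false = []
  ... | true  = (move i (take (toℕ j) p) (drop (suc (toℕ j)) p) p-split
                , updateAt≡∷= ps i (take (toℕ j))) ∷ []
    where
    p = lookup ps i
    p-split : p ≡ take (toℕ j) p ++ c ∷ drop (suc (toℕ j)) p
    p-split = subst (λ d → p ≡ take (toℕ j) p ++ d ∷ drop (suc (toℕ j)) p) (≡ᶜ-sound is-c)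
                    (split-at p j)

index-of : ∀ {c : Colour} (p pre post : Pile) → p ≡ pre ++ c ∷ post →
  Σ (Fin (length p)) λ j → lookup p j ≡ c × take (toℕ j) p ≡ pre
index-of _ []        post refl = zero , refl , refl
index-of _ (d ∷ pre) post refl with index-of _ pre post refl
... | j , at-j , prefix = suc j , at-j , cong (d ∷_) prefix

options-complete : ∀ {c ps} (m : Move c ps) → play m ∈ options c ps
options-complete {c} {ps} m = at (index-of p (kept m) (removed m) (split m))
  where
  p = lookup ps (pile m)
  at : Σ (Fin (length p)) (λ j → lookup p j ≡ c × take (toℕ j) p ≡ kept m) → play m ∈ options c ps
  at (j , at-j , prefix) =
    AnyP.concat⁺ (AnyP.map⁺ (AnyP.tabulate⁺ (pile m) (AnyP.concat⁺ (AnyP.map⁺ (AnyP.tabulate⁺ j option)))))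
    where
    option : play m ∈ (if lookup p j ≡ᶜ c then updateAt ps (pile m) (take (toℕ j)) ∷ [] else [])
    option rewrite at-j | ≡ᶜ-refl c =
      here (trans (cong (ps [ pile m ]∷=_) (sym prefix)) (sym (updateAt≡∷= ps (pile m) (take (toℕ j)))))

depthMax : Position → ℕ
depthMax []       = 0
depthMax (p ∷ ps) = topDepth p ⊔ depthMax ps

Dyadic-value : ∀ ps → Dyadic (depthMax ps) (value ps)
Dyadic-value ps = go ps ℕP.≤-refl
  where
  go : ∀ {E} ps → depthMax ps ℕ.≤ E → Dyadic E (value ps)
  go []       _     = Dyadic-ι (+ 0)
  go (p ∷ ps) max≤E = Dyadic-+
    (Dyadic-pileValue p (ℕP.≤-trans (ℕP.m≤m⊔n (topDepth p) (depthMax ps)) max≤E))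
    (go ps (ℕP.≤-trans (ℕP.m≤n⊔m (topDepth p) (depthMax ps)) max≤E))

depthMax-attained : ∀ ps →
  depthMax ps ≡ 0 ⊎ Σ (Fin (length ps)) λ i → topDepth (lookup ps i) ≡ depthMax ps
depthMax-attained []       = inj₁ refl
depthMax-attained (p ∷ ps) with topDepth p ℕ.≤? depthMax ps | depthMax-attained ps
... | no  top≰max | _              = inj₂ (zero , sym (ℕP.m≥n⇒m⊔n≡m (ℕP.<⇒≤ (ℕP.≰⇒> top≰max))))
... | yes top≤max | inj₁ max≡0     = inj₁ (trans (ℕP.m≤n⇒m⊔n≡n top≤max) max≡0)
... | yes top≤max | inj₂ (i , top) = inj₂ (suc i , trans top (sym (ℕP.m≤n⇒m⊔n≡n top≤max)))

depthMax-pos : ∀ ps → allMonochromatic ps ≡ false → 1 ℕ.≤ depthMax ps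
depthMax-pos (p ∷ ps) not-mono with monochromatic p in p-mono
... | true  = ℕP.≤-trans (depthMax-pos ps not-mono) (ℕP.m≤n⊔m (topDepth p) (depthMax ps))
... | false = ℕP.≤-trans (deep-if-mixed p p-mono) (ℕP.m≤m⊔n (topDepth p) (depthMax ps))

smallest-move : ∀ c ps → allMonochromatic ps ≡ false →
  Σ (Move c ps) λ m → moveValue m ≡ sign c ℚ.* ½^ (depthMax ps)
smallest-move c ps not-mono with depthMax-attained ps | depthMax-pos ps not-mono
... | inj₁ max≡0 | 1≤max rewrite max≡0 with 1≤max
...   | ()
smallest-move c ps not-mono | inj₂ (i , top≡max) | 1≤max
  with top-counter c (lookup ps i) (subst (1 ℕ.≤_) (sym top≡max) 1≤max)
... | pre , r , split , worth =
  move i pre (replicate r (other c)) split , trans worth (cong (λ k → sign c ℚ.* ½^ k) top≡max)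

balance : Pile → ℤ
balance p = + count blue p ℤ.- + count red p

signℤ : Colour → ℤ
signℤ blue = ℤ.1ℤ
signℤ red  = ℤ.-1ℤ

ι-signℤ : ∀ c → ι (signℤ c) ≡ sign c
ι-signℤ blue = refl
ι-signℤ red  = refl

balance-∷ : ∀ c cs → balance (c ∷ cs) ≡ signℤ c ℤ.+ balance cs
balance-∷ blue cs = trans (cong (ℤ._- + count red cs) (ℤP.pos-+ 1 (count blue cs)))
  (shift (+ count blue cs) (+ count red cs))
  where
  shift : ∀ x y → (ℤ.1ℤ ℤ.+ x) ℤ.- y ≡ ℤ.1ℤ ℤ.+ (x ℤ.- y)
  shift = ℤSolver.solve-∀
balance-∷ red  cs = trans (cong (ℤ._-_ (+ count blue cs)) (ℤP.pos-+ 1 (count red cs)))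
  (shift (+ count blue cs) (+ count red cs))
  where
  shift : ∀ x y → x ℤ.- (ℤ.1ℤ ℤ.+ y) ≡ ℤ.-1ℤ ℤ.+ (x ℤ.- y)
  shift = ℤSolver.solve-∀

-- Counters continuing a pile of a single colour each have weight 1, so
-- they are worth their balance.
uniform-value : ∀ c bs cs → allB (_≡ᶜ c) bs ≡ true → allB (_≡ᶜ c) cs ≡ true →
  stackValue (base bs 0) cs ≡ ι (balance cs)
uniform-value c bs []       _    _    = refl
uniform-value c bs (d ∷ cs) bs-c cs-c with d ≡ᶜ c in d≡c
... | true rewrite ≡ᶜ-sound d≡c | bs-c = begin
  sign c ℚ.* 1ℚ ℚ.+ stackValue (base (c ∷ bs) 0) cs
    ≡⟨ cong₂ ℚ._+_ (trans (ℚP.*-identityʳ (sign c)) (sym (ι-signℤ c)))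
                   (uniform-value c (c ∷ bs) cs (trans (allB-same c bs) bs-c) cs-c) ⟩
  ι (signℤ c) ℚ.+ ι (balance cs)    ≡⟨ ι-+ (signℤ c) (balance cs) ⟨
  ι (signℤ c ℤ.+ balance cs)        ≡⟨ cong ι (balance-∷ c cs) ⟨
  ι (balance (c ∷ cs))              ∎
  where open ≡-Reasoning

value-terminal : ∀ ps → allMonochromatic ps ≡ true → value ps ≡ ι (payoff ps)
value-terminal []       _        = refl
value-terminal (p ∷ ps) all-mono with monochromatic p in p-mono
... | true = trans (cong₂ ℚ._+_ (pile-terminal p p-mono) (value-terminal ps all-mono))
                   (sym (ι-+ (balance p) (payoff ps)))
  where
  pile-terminal : ∀ p → monochromatic p ≡ true → pileValue p ≡ ι (balance p)
  pile-terminal []       _    = refl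
  pile-terminal (c ∷ cs) mono = trans (pileValue≡stackValue (c ∷ cs))
    (uniform-value c [] (c ∷ cs) refl (trans (allB-same c cs) mono))

maxList-≤ : ∀ d x xs t → All (ℤ._≤ t) (x ∷ xs) → maxList d (x ∷ xs) ℤ.≤ t
maxList-≤ d x []       t (x≤t ∷ []) = x≤t
maxList-≤ d x (y ∷ ys) t (x≤t ∷ ≤t) = ℤP.⊔-lub x≤t (maxList-≤ d y ys t ≤t)

maxList-char : ∀ d xs t → All (ℤ._≤ t) xs → Any (_≡ t) xs → maxList d xs ≡ t
maxList-char d (x ∷ [])     t _          (here x≡t) = x≡t
maxList-char d (x ∷ y ∷ ys) t (_ ∷ ≤t)   (here refl) = ℤP.i≥j⇒i⊔j≡i (maxList-≤ d y ys t ≤t)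
maxList-char d (x ∷ y ∷ ys) t (x≤t ∷ ≤t) (there ≡t) =
  trans (cong (x ℤ.⊔_) (maxList-char d (y ∷ ys) t ≤t ≡t)) (ℤP.i≤j⇒i⊔j≡j x≤t)

minList-≥ : ∀ d x xs t → All (t ℤ.≤_) (x ∷ xs) → t ℤ.≤ minList d (x ∷ xs)
minList-≥ d x []       t (t≤x ∷ []) = t≤x
minList-≥ d x (y ∷ ys) t (t≤x ∷ t≤) = ℤP.⊓-glb t≤x (minList-≥ d y ys t t≤)

minList-char : ∀ d xs t → All (t ℤ.≤_) xs → Any (_≡ t) xs → minList d xs ≡ t
minList-char d (x ∷ [])     t _          (here x≡t) = x≡t
minList-char d (x ∷ y ∷ ys) t (_ ∷ t≤)   (here refl) = ℤP.i≤j⇒i⊓j≡i (minList-≥ d y ys t t≤)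
minList-char d (x ∷ y ∷ ys) t (t≤x ∷ t≤) (there ≡t) =
  trans (cong (x ℤ.⊓_) (minList-char d (y ∷ ys) t t≤ ≡t)) (ℤP.i≥j⇒i⊓j≡j t≤x)

blue-turn : ∀ (f : Position → ℤ) d ps → allMonochromatic ps ≡ false →
  (∀ (m : Move blue ps) → f (play m) ≡ roundFor red (value (play m))) →
  maxList d (map f (options blue ps)) ≡ roundFor blue (value ps)
blue-turn f d ps not-mono f-correct = maxList-char d _ _
  (AllP.map⁺ (All.map bounded (options-sound blue ps)))
  (AnyP.map⁺ (reached (smallest-move blue ps not-mono)))
  where
  bounded : ∀ {o} → Σ (Move blue ps) (λ m → o ≡ play m) → f o ℤ.≤ roundFor blue (value ps)
  bounded (m , refl) = subst (ℤ._≤ _) (sym (f-correct m)) (round-mono (begin-strict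
    value (play m)                   <⟨ <+pos (value (play m)) move>0 ⟩
    value (play m) ℚ.+ moveValue m   ≡⟨ value-play m ⟨
    value ps                         ∎))
    where
    open ℚP.≤-Reasoning
    move>0 : 0ℚ ℚ.< moveValue m
    move>0 = subst (0ℚ ℚ.<_) (ℚP.*-identityˡ (moveValue m)) (moveValue-sign m)
  reached : Σ (Move blue ps) (λ m → moveValue m ≡ sign blue ℚ.* ½^ (depthMax ps)) →
            Any (λ o → f o ≡ roundFor blue (value ps)) (options blue ps)
  reached (m , worth) = lose (options-complete m)
    (trans (f-correct m) (round-exact (value (play m)) (Dyadic-value ps) (depthMax-pos ps not-mono) one-step))
    where
    one-step : value (play m) ℚ.+ ½^ (depthMax ps) ≡ value ps
    one-step = trans (cong (value (play m) ℚ.+_) (trans (sym (ℚP.*-identityˡ _)) (sym worth)))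
                     (sym (value-play m))

red-turn : ∀ (f : Position → ℤ) d ps → allMonochromatic ps ≡ false →
  (∀ (m : Move red ps) → f (play m) ≡ roundFor blue (value (play m))) →
  minList d (map f (options red ps)) ≡ roundFor red (value ps)
red-turn f d ps not-mono f-correct = minList-char d _ _
  (AllP.map⁺ (All.map bounded (options-sound red ps)))
  (AnyP.map⁺ (reached (smallest-move red ps not-mono)))
  where
  bounded : ∀ {o} → Σ (Move red ps) (λ m → o ≡ play m) → roundFor red (value ps) ℤ.≤ f o
  bounded (m , refl) = subst (_ ℤ.≤_) (sym (f-correct m)) (round-mono (begin-strict
    value ps                         ≡⟨ value-play m ⟩
    value (play m) ℚ.+ moveValue m   <⟨ ℚP.+-monoʳ-< (value (play m)) move<0 ⟩
    value (play m) ℚ.+ 0ℚ            ≡⟨ ℚP.+-identityʳ (value (play m)) ⟩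
    value (play m)                   ∎))
    where
    open ℚP.≤-Reasoning
    move<0 : moveValue m ℚ.< 0ℚ
    move<0 = subst (ℚ._< 0ℚ) (neg-involutive (moveValue m))
      (ℚP.neg-antimono-< (subst (0ℚ ℚ.<_) (neg-one-* (moveValue m)) (moveValue-sign m)))
  reached : Σ (Move red ps) (λ m → moveValue m ≡ sign red ℚ.* ½^ (depthMax ps)) →
            Any (λ o → f o ≡ roundFor red (value ps)) (options red ps)
  reached (m , worth) = lose (options-complete m) (trans (f-correct m)
    (sym (round-exact (value ps) (subst (Dyadic _) one-step grid) (depthMax-pos ps not-mono) one-step)))
    where
    u = ½^ (depthMax ps)
    one-step : value ps ℚ.+ u ≡ value (play m)
    one-step = begin
      value ps ℚ.+ u                          ≡⟨ cong (ℚ._+ u) (value-play m) ⟩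
      value (play m) ℚ.+ moveValue m ℚ.+ u
        ≡⟨ cong (λ x → value (play m) ℚ.+ x ℚ.+ u) (trans worth (neg-one-* u)) ⟩
      value (play m) ℚ.+ ℚ.- u ℚ.+ u          ≡⟨ sub-add (value (play m)) u ⟩
      value (play m)                          ∎
      where
      open ≡-Reasoning
      sub-add : ∀ a u → a ℚ.+ ℚ.- u ℚ.+ u ≡ a
      sub-add = solve-∀ ℚ-ring
    grid : Dyadic (depthMax ps) (value ps ℚ.+ u)
    grid = Dyadic-+ (Dyadic-value ps) (Dyadic-½^ ℕP.≤-refl)

minimax-correct : ∀ n c ps → size ps ℕ.< n → minimax n c ps ≡ roundFor c (value ps)
minimax-correct (suc n) c ps size<n with allMonochromatic ps in terminal
... | true = trans (sym (roundFor-ι c (payoff ps))) (cong (roundFor c) (sym (value-terminal ps terminal)))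
... | false with c
...   | blue = blue-turn (minimax n red)  (payoff ps) ps terminal
                   (λ m → minimax-correct n red  (play m) (play-fuel size<n m))
...   | red  = red-turn  (minimax n blue) (payoff ps) ps terminal
                   (λ m → minimax-correct n blue (play m) (play-fuel size<n m))

theorem3 : (c : Colour) (ps : Position) → result c ps ≡ roundFor c (value ps)
theorem3 c ps = minimax-correct (suc (size ps)) c ps ℕP.≤-refl
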